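{- Let $H$ be the graph obtained from the disjoint union of two paths on three vertices by adding an edge between their central vertices. If a connected triangle-free graph $G$ contains $H$ as a subgraph (not necessarily induced), then $\mu(G)\ge 4$.
   Context: For a connected graph $G$ and $X\subseteq V(G)$, two vertices $x,y\in X$ are $X$-visible if there is a shortest $x,y$-path $P$ in $G$ with $V(P)\cap X=\{x,y\}$; $X$ is a mutual-visibility set if every two vertices of $X$ are $X$-visible; $\mu(G)$ is the largest size of a mutual-visibility set of $G$. -}

module Defs where

open import Data.Nat using (ℕ; zero; suc; _≤_)
open import Data.Fin using (Fin)
open import Data.Fin.Subset using (Subset; _∈_; _∉_; ∣_∣)
open import Data.Bool using (Bool; true; false)
open import Data.Product using (Σ; ∃; _×_; _,_)
open import Data.Unit using (⊤)
open import Data.Empty using (⊥)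
open import Relation.Nullary using (¬_)
open import Relation.Binary.PropositionalEquality using (_≡_)
open import Function.Definitions using (Injective)

record Graph (n : ℕ) : Set where
  field
    adj     : Fin n → Fin n → Bool
    sym     : ∀ x y → adj x y ≡ adj y x
    irrefl  : ∀ x → adj x x ≡ false

open Graph public

Adj : ∀ {n} → Graph n → Fin n → Fin n → Set
Adj G x y = adj G x y ≡ true

data Walk {n : ℕ} (G : Graph n) : Fin n → Fin n → ℕ → Set where
  []  : ∀ {x} → Walk G x x zero
  _∷_ : ∀ {x y z k} → Adj G x y → Walk G y z k → Walk G x z (suc k)

Connected : ∀ {n} → Graph n → Set
Connected G = ∀ x y → ∃ λ k → Walk G x y k

-- A shortest x,y-walk (necessarily a path): no x,y-walk has fewer edges.
Shortest : ∀ {n} {G : Graph n} {x y k} → Walk G x y k → Set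
Shortest {G = G} {x} {y} {k} _ = ∀ m → Walk G x y m → k ≤ m

AvoidFrom : ∀ {n} {G : Graph n} {x y k} → Subset n → Walk G x y k → Set
AvoidFrom X [] = ⊤
AvoidFrom X (_∷_ {x = x} e w) = (x ∉ X) × AvoidFrom X w

InteriorAvoids : ∀ {n} {G : Graph n} {x y k} → Subset n → Walk G x y k → Set
InteriorAvoids X [] = ⊤
InteriorAvoids X (e ∷ w) = AvoidFrom X w

Visible : ∀ {n} → Graph n → Subset n → Fin n → Fin n → Set
Visible G X x y = Σ ℕ λ k → Σ (Walk G x y k) λ P → Shortest P × InteriorAvoids X P

MutualVisibility : ∀ {n} → Graph n → Subset n → Set
MutualVisibility G X = ∀ x y → x ∈ X → y ∈ X → ¬ (x ≡ y) → Visible G X x y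

μ≥ : ∀ {n} → Graph n → ℕ → Set
μ≥ {n} G k = Σ (Subset n) λ X → MutualVisibility G X × k ≤ ∣ X ∣

TriangleFree : ∀ {n} → Graph n → Set
TriangleFree G = ∀ a b c → Adj G a b → Adj G b c → Adj G a c → ⊥

-- The graph H: two P3's  0 - 1 - 2  and  3 - 4 - 5  plus the edge 1 - 4
-- between their central vertices (edges listed in one orientation).
data HEdge : Fin 6 → Fin 6 → Set where
  e01 : HEdge (Fin.zero) (Fin.suc Fin.zero)
  e12 : HEdge (Fin.suc Fin.zero) (Fin.suc (Fin.suc Fin.zero))
  e34 : HEdge (Fin.suc (Fin.suc (Fin.suc Fin.zero))) (Fin.suc (Fin.suc (Fin.suc (Fin.suc Fin.zero))))
  e45 : HEdge (Fin.suc (Fin.suc (Fin.suc (Fin.suc Fin.zero)))) (Fin.suc (Fin.suc (Fin.suc (Fin.suc (Fin.suc Fin.zero)))))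
  e14 : HEdge (Fin.suc Fin.zero) (Fin.suc (Fin.suc (Fin.suc (Fin.suc Fin.zero))))

ContainsH : ∀ {n} → Graph n → Set
ContainsH {n} G = Σ (Fin 6 → Fin n) λ f →
  Injective _≡_ _≡_ f × (∀ i j → HEdge i j → Adj G (f i) (f j))

-- Let a₁, b₁ be the adjacent centres of the two P₃'s of H, with leaves a₀, a₂ and
-- b₀, b₂, and take X = {a₀, a₂, b₀, b₂}. Triangle-freeness makes both leaf pairs
-- non-adjacent, so a vertex adjacent to a leaf on one side and to a leaf on the
-- other cannot itself be a leaf. Hence two leaves on the same side see each other
-- through their centre, and leaves a, b on different sides see each other along
-- a shortest path: the edge ab, a common neighbour, or else a a₁ b₁ b.
module Submission where

open import Defs
open import Data.Nat using (ℕ; suc; _+_; _≤_; z≤n; s≤s)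
open import Data.Nat.Properties using (+-suc; ≤-reflexive)
open import Data.Fin using (Fin; #_)
open import Data.Fin.Subset using (Subset; _∈_; _∉_; ∣_∣; ⁅_⁆; _∪_; inside; outside)
open import Data.Fin.Subset.Properties using (x∈⁅y⁆⇒x≡y; x∈p∪q⁻; x≢y⇒x∉⁅y⁆; ∣⁅x⁆∣≡1)
open import Data.Fin.Properties using (any?)
open import Data.Bool using (true)
import Data.Bool as Bool
open import Data.Vec using (_∷_; []; here; there)
open import Data.Product using (∃; _×_; _,_)
open import Data.Sum using (_⊎_; inj₁; inj₂)
open import Data.Unit using (tt)
open import Data.Empty using (⊥-elim)
open import Function using (_∘′_)
open import Relation.Nullary using (¬_; Dec; yes; no)
open import Relation.Nullary.Decidable using (_×-dec_)
open import Relation.Binary.PropositionalEquality using (_≡_; _≢_; refl; cong)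
import Relation.Binary.PropositionalEquality as ≡
open ≡.≡-Reasoning

Disjoint : ∀ {n} → Subset n → Subset n → Set
Disjoint p q = ∀ {x} → x ∈ p → x ∉ q

Disjoint-tail : ∀ {n s t} {p q : Subset n} → Disjoint (s ∷ p) (t ∷ q) → Disjoint p q
Disjoint-tail disjoint x∈p = disjoint (there x∈p) ∘′ there

∣p∪q∣≡∣p∣+∣q∣ : ∀ {n} (p q : Subset n) → Disjoint p q → ∣ p ∪ q ∣ ≡ ∣ p ∣ + ∣ q ∣
∣p∪q∣≡∣p∣+∣q∣ []            []            _        = refl
∣p∪q∣≡∣p∣+∣q∣ (inside  ∷ p) (inside  ∷ q) disjoint = ⊥-elim (disjoint here here)
∣p∪q∣≡∣p∣+∣q∣ (inside  ∷ p) (outside ∷ q) disjoint =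
  cong suc (∣p∪q∣≡∣p∣+∣q∣ p q (Disjoint-tail disjoint))
∣p∪q∣≡∣p∣+∣q∣ (outside ∷ p) (outside ∷ q) disjoint =
  ∣p∪q∣≡∣p∣+∣q∣ p q (Disjoint-tail disjoint)
∣p∪q∣≡∣p∣+∣q∣ (outside ∷ p) (inside  ∷ q) disjoint = begin
  suc ∣ p ∪ q ∣       ≡⟨ cong suc (∣p∪q∣≡∣p∣+∣q∣ p q (Disjoint-tail disjoint)) ⟩
  suc (∣ p ∣ + ∣ q ∣) ≡⟨ ≡.sym (+-suc ∣ p ∣ ∣ q ∣) ⟩
  ∣ p ∣ + suc ∣ q ∣   ∎

x∈⁅y⁆∪⁅z⁆⇒x≡y⊎x≡z : ∀ {n} {x y z : Fin n} → x ∈ ⁅ y ⁆ ∪ ⁅ z ⁆ → x ≡ y ⊎ x ≡ z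
x∈⁅y⁆∪⁅z⁆⇒x≡y⊎x≡z {y = y} {z} x∈yz with x∈p∪q⁻ ⁅ y ⁆ ⁅ z ⁆ x∈yz
... | inj₁ x∈y = inj₁ (x∈⁅y⁆⇒x≡y y x∈y)
... | inj₂ x∈z = inj₂ (x∈⁅y⁆⇒x≡y z x∈z)

x≢y⇒x≢z⇒x∉⁅y⁆∪⁅z⁆ : ∀ {n} {x y z : Fin n} → x ≢ y → x ≢ z → x ∉ ⁅ y ⁆ ∪ ⁅ z ⁆
x≢y⇒x≢z⇒x∉⁅y⁆∪⁅z⁆ x≢y x≢z x∈yz with x∈⁅y⁆∪⁅z⁆⇒x≡y⊎x≡z x∈yz
... | inj₁ x≡y = x≢y x≡y
... | inj₂ x≡z = x≢z x≡z

∣⁅x⁆∪⁅y⁆∣≡2 : ∀ {n} {x y : Fin n} → x ≢ y → ∣ ⁅ x ⁆ ∪ ⁅ y ⁆ ∣ ≡ 2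
∣⁅x⁆∪⁅y⁆∣≡2 {x = x} {y} x≢y = begin
  ∣ ⁅ x ⁆ ∪ ⁅ y ⁆ ∣     ≡⟨ ∣p∪q∣≡∣p∣+∣q∣ ⁅ x ⁆ ⁅ y ⁆ disjoint ⟩
  ∣ ⁅ x ⁆ ∣ + ∣ ⁅ y ⁆ ∣ ≡⟨ ≡.cong₂ _+_ (∣⁅x⁆∣≡1 x) (∣⁅x⁆∣≡1 y) ⟩
  2                    ∎
  where
  disjoint : Disjoint ⁅ x ⁆ ⁅ y ⁆
  disjoint u∈x with refl ← x∈⁅y⁆⇒x≡y x u∈x = x≢y⇒x∉⁅y⁆ x≢y

module _ {n : ℕ} (G : Graph n) where

  Adj-sym : ∀ {x y} → Adj G x y → Adj G y x
  Adj-sym {x} {y} x~y = ≡.trans (sym G y x) x~y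

  Adj-irrefl : ∀ {x} → ¬ Adj G x x
  Adj-irrefl {x} x~x with () ← ≡.trans (≡.sym x~x) (irrefl G x)

  Adj? : ∀ x y → Dec (Adj G x y)
  Adj? x y = adj G x y Bool.≟ true

  CommonNeighbour : Fin n → Fin n → Set
  CommonNeighbour x y = ∃ λ w → Adj G x w × Adj G w y

  Independent : Subset n → Set
  Independent A = ∀ {u v} → u ∈ A → v ∈ A → ¬ Adj G u v

  distinct⇒walk-length≥1 : ∀ {x y k} → x ≢ y → Walk G x y k → 1 ≤ k
  distinct⇒walk-length≥1 x≢x []      = ⊥-elim (x≢x refl)
  distinct⇒walk-length≥1 _   (_ ∷ _) = s≤s z≤n

  nonadjacent⇒walk-length≥2 : ∀ {x y k} → x ≢ y → ¬ Adj G x y → Walk G x y k → 2 ≤ k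
  nonadjacent⇒walk-length≥2 x≢x _   []          = ⊥-elim (x≢x refl)
  nonadjacent⇒walk-length≥2 _   x≁y (x~y ∷ [])  = ⊥-elim (x≁y x~y)
  nonadjacent⇒walk-length≥2 _   _   (_ ∷ _ ∷ _) = s≤s (s≤s z≤n)

  no-common-neighbour⇒walk-length≥3 : ∀ {x y k} → x ≢ y → ¬ Adj G x y → ¬ CommonNeighbour x y
                                   → Walk G x y k → 3 ≤ k
  no-common-neighbour⇒walk-length≥3 x≢x _   _   []                = ⊥-elim (x≢x refl)
  no-common-neighbour⇒walk-length≥3 _   x≁y _   (x~y ∷ [])        = ⊥-elim (x≁y x~y)
  no-common-neighbour⇒walk-length≥3 _   _   ∄w  (x~w ∷ w~y ∷ [])  = ⊥-elim (∄w (_ , x~w , w~y))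
  no-common-neighbour⇒walk-length≥3 _   _   _   (_ ∷ _ ∷ _ ∷ _)   = s≤s (s≤s (s≤s z≤n))

  module _ (X : Subset n) where

    visible-adjacent : ∀ {x y} → x ≢ y → Adj G x y → Visible G X x y
    visible-adjacent x≢y x~y = 1 , x~y ∷ [] , (λ _ → distinct⇒walk-length≥1 x≢y) , tt

    visible-via : ∀ {x p y} → x ≢ y → Adj G x p → Adj G p y → p ∉ X → Visible G X x y
    visible-via {x} {p} {y} x≢y x~p p~y p∉X with Adj? x y
    ... | yes x~y = visible-adjacent x≢y x~y
    ... | no  x≁y = 2 , x~p ∷ p~y ∷ [] , (λ _ → nonadjacent⇒walk-length≥2 x≢y x≁y) , p∉X , tt

    visible-via₂ : ∀ {x p q y} → x ≢ y → Adj G x p → Adj G p q → Adj G q y → p ∉ X → q ∉ X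
                 → (∀ {w} → Adj G x w → Adj G w y → w ∉ X) → Visible G X x y
    visible-via₂ {x} {p} {q} {y} x≢y x~p p~q q~y p∉X q∉X common∉X with Adj? x y
    ... | yes x~y = visible-adjacent x≢y x~y
    ... | no  x≁y with any? (λ w → Adj? x w ×-dec Adj? w y)
    ...   | yes (w , x~w , w~y) = visible-via x≢y x~w w~y (common∉X x~w w~y)
    ...   | no  ∄w = 3 , x~p ∷ p~q ∷ q~y ∷ []
                   , (λ _ → no-common-neighbour⇒walk-length≥3 x≢y x≁y ∄w)
                   , p∉X , q∉X , tt

  mutualVisibility-∪ : ∀ {A B c d} → Adj G c d → Independent A → Independent B
                     → (∀ {x} → x ∈ A → Adj G x c) → (∀ {y} → y ∈ B → Adj G d y)
                     → c ∉ B → d ∉ A → MutualVisibility G (A ∪ B)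
  mutualVisibility-∪ {A} {B} {c} {d} c~d A-indep B-indep A~c d~B c∉B d∉A = visible
    where
    X : Subset n
    X = A ∪ B

    ∉-∪ : ∀ {v} → v ∉ A → v ∉ B → v ∉ X
    ∉-∪ v∉A v∉B v∈X with x∈p∪q⁻ A B v∈X
    ... | inj₁ v∈A = v∉A v∈A
    ... | inj₂ v∈B = v∉B v∈B

    c∉X : c ∉ X
    c∉X = ∉-∪ (λ c∈A → Adj-irrefl (A~c c∈A)) c∉B

    d∉X : d ∉ X
    d∉X = ∉-∪ d∉A (λ d∈B → Adj-irrefl (d~B d∈B))

    common-neighbour∉X : ∀ {a b w} → a ∈ A → b ∈ B → Adj G a w → Adj G w b → w ∉ X
    common-neighbour∉X a∈A b∈B a~w w~b =
      ∉-∪ (λ w∈A → A-indep a∈A w∈A a~w) (λ w∈B → B-indep w∈B b∈B w~b)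

    visible : MutualVisibility G X
    visible x y x∈X y∈X x≢y with x∈p∪q⁻ A B x∈X | x∈p∪q⁻ A B y∈X
    ... | inj₁ x∈A | inj₁ y∈A = visible-via X x≢y (A~c x∈A) (Adj-sym (A~c y∈A)) c∉X
    ... | inj₂ x∈B | inj₂ y∈B = visible-via X x≢y (Adj-sym (d~B x∈B)) (d~B y∈B) d∉X
    ... | inj₁ x∈A | inj₂ y∈B =
      visible-via₂ X x≢y (A~c x∈A) c~d (d~B y∈B) c∉X d∉X (common-neighbour∉X x∈A y∈B)
    ... | inj₂ x∈B | inj₁ y∈A =
      visible-via₂ X x≢y (Adj-sym (d~B x∈B)) (Adj-sym c~d) (Adj-sym (A~c y∈A)) d∉X c∉X
        (λ x~w w~y → common-neighbour∉X y∈A x∈B (Adj-sym w~y) (Adj-sym x~w))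

  independent-⁅x⁆∪⁅y⁆ : ∀ {x y} → ¬ Adj G x y → Independent (⁅ x ⁆ ∪ ⁅ y ⁆)
  independent-⁅x⁆∪⁅y⁆ x≁y u∈ v∈ with x∈⁅y⁆∪⁅z⁆⇒x≡y⊎x≡z u∈ | x∈⁅y⁆∪⁅z⁆⇒x≡y⊎x≡z v∈
  ... | inj₁ refl | inj₁ refl = Adj-irrefl
  ... | inj₁ refl | inj₂ refl = x≁y
  ... | inj₂ refl | inj₁ refl = x≁y ∘′ Adj-sym
  ... | inj₂ refl | inj₂ refl = Adj-irrefl

  ⁅x⁆∪⁅y⁆⊆neighbours : ∀ {x y c} → Adj G x c → Adj G y c → ∀ {u} → u ∈ ⁅ x ⁆ ∪ ⁅ y ⁆ → Adj G u c
  ⁅x⁆∪⁅y⁆⊆neighbours x~c y~c u∈ with x∈⁅y⁆∪⁅z⁆⇒x≡y⊎x≡z u∈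
  ... | inj₁ refl = x~c
  ... | inj₂ refl = y~c

lemma4p3 : ∀ (n : ℕ) (G : Graph n) → Connected G → TriangleFree G → ContainsH G → μ≥ G 4
lemma4p3 n G _ triangle-free (f , f-injective , f-edge) =
  A ∪ B
  , mutualVisibility-∪ G a₁~b₁ (independent-⁅x⁆∪⁅y⁆ G a₀≁a₂) (independent-⁅x⁆∪⁅y⁆ G b₀≁b₂)
      (⁅x⁆∪⁅y⁆⊆neighbours G a₀~a₁ (Adj-sym G a₁~a₂))
      (Adj-sym G ∘′ ⁅x⁆∪⁅y⁆⊆neighbours G b₀~b₁ (Adj-sym G b₁~b₂))
      (x≢y⇒x≢z⇒x∉⁅y⁆∪⁅z⁆ (f-distinct λ ()) (f-distinct λ ()))
      (x≢y⇒x≢z⇒x∉⁅y⁆∪⁅z⁆ (f-distinct λ ()) (f-distinct λ ()))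
  , ≤-reflexive (≡.sym ∣A∪B∣≡4)
  where
  a₀ a₁ a₂ b₀ b₁ b₂ : Fin n
  a₀ = f (# 0)
  a₁ = f (# 1)
  a₂ = f (# 2)
  b₀ = f (# 3)
  b₁ = f (# 4)
  b₂ = f (# 5)

  a₀~a₁ : Adj G a₀ a₁
  a₀~a₁ = f-edge _ _ e01
  a₁~a₂ : Adj G a₁ a₂
  a₁~a₂ = f-edge _ _ e12
  b₀~b₁ : Adj G b₀ b₁
  b₀~b₁ = f-edge _ _ e34
  b₁~b₂ : Adj G b₁ b₂
  b₁~b₂ = f-edge _ _ e45
  a₁~b₁ : Adj G a₁ b₁
  a₁~b₁ = f-edge _ _ e14

  a₀≁a₂ : ¬ Adj G a₀ a₂
  a₀≁a₂ = triangle-free a₀ a₁ a₂ a₀~a₁ a₁~a₂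
  b₀≁b₂ : ¬ Adj G b₀ b₂
  b₀≁b₂ = triangle-free b₀ b₁ b₂ b₀~b₁ b₁~b₂

  A B : Subset n
  A = ⁅ a₀ ⁆ ∪ ⁅ a₂ ⁆
  B = ⁅ b₀ ⁆ ∪ ⁅ b₂ ⁆

  f-distinct : ∀ {i j} → i ≢ j → f i ≢ f j
  f-distinct i≢j = i≢j ∘′ f-injective

  A-B-disjoint : Disjoint A B
  A-B-disjoint u∈A with x∈⁅y⁆∪⁅z⁆⇒x≡y⊎x≡z u∈A
  ... | inj₁ refl = x≢y⇒x≢z⇒x∉⁅y⁆∪⁅z⁆ (f-distinct λ ()) (f-distinct λ ())
  ... | inj₂ refl = x≢y⇒x≢z⇒x∉⁅y⁆∪⁅z⁆ (f-distinct λ ()) (f-distinct λ ())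

  ∣A∪B∣≡4 : ∣ A ∪ B ∣ ≡ 4
  ∣A∪B∣≡4 = begin
    ∣ A ∪ B ∣     ≡⟨ ∣p∪q∣≡∣p∣+∣q∣ A B A-B-disjoint ⟩
    ∣ A ∣ + ∣ B ∣ ≡⟨ ≡.cong₂ _+_ (∣⁅x⁆∪⁅y⁆∣≡2 (f-distinct λ ())) (∣⁅x⁆∪⁅y⁆∣≡2 (f-distinct λ ())) ⟩
    4             ∎
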